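{- Let $\mathcal S$ be the variety of symmetric $\mathcal I$-zroupoids and, for $1 \le i \le 14$, let $\mathcal S_i = \mathcal A_i \cap \mathcal S$. Then: (a) $\mathcal{SL}$, $\mathcal S_{14}$ and $\mathcal S$ are the subvarieties of $\mathcal S$ of associative type, and they are pairwise distinct (i.e. each $\mathcal S_i$, $1\le i\le 14$, equals one of these three, and the three are distinct). (b) $\mathcal{SL} \subset \mathcal S_{14} \subset \mathcal S$ (strict inclusions), and $\mathcal{BA} \not\subseteq \mathcal S_{14}$.
   Context: An $\mathcal I$-zroupoid is an algebra $\langle A,\to,0\rangle$ ($\to$ binary, $0$ constant) satisfying $(x \to y) \to z \approx [(z' \to x) \to (y \to z)']'$ and $0''\approx 0$, where $x' := x \to 0$ (prime binds tighter than $\to$); $\mathcal I$ is the variety of $\mathcal I$-zroupoids. Put $x \wedge y := (x \to y')'$. An $\mathcal I$-zroupoid is symmetric if it satisfies $x'' \approx x$ and $x \wedge y \approx y \wedge x$; $\mathcal S$ denotes the variety of symmetric $\mathcal I$-zroupoids. The identities (A1)–(A14) are: (A1) $x \to (y \to z) \approx (x \to y) \to z$; (A2) $x \to (y \to z) \approx x \to (z \to y)$; (A3) $x \to (y \to z) \approx (x \to z) \to y$; (A4) $x \to (y \to z) \approx y \to (x \to z)$; (A5) $x \to (y \to z) \approx (y \to x) \to z$; (A6) $x \to (y \to z) \approx y \to (z \to x)$; (A7) $x \to (y \to z) \approx (y \to z) \to x$; (A8) $x \to (y \to z) \approx (z \to x) \to y$; (A9) $x \to (y \to z) \approx z \to (y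 \to x)$; (A10) $x \to (y \to z) \approx (z \to y) \to x$; (A11) $(x \to y) \to z \approx (x \to z) \to y$; (A12) $(x \to y) \to z \approx (y \to x) \to z$; (A13) $(x \to y) \to z \approx (y \to z) \to x$; (A14) $(x \to y) \to z \approx (z \to y) \to x$. $\mathcal A_i$ is the subvariety of $\mathcal I$ defined by (Ai). A subvariety of $\mathcal S$ of associative type is one defined relative to $\mathcal S$ by a single identity $p\approx q$ in which each side contains exactly the three distinct variables $x,y,z$, each once, bracketed as $\star\to(\star\to\star)$ or $(\star\to\star)\to\star$ (each such variety equals some $\mathcal S_i$). $\mathcal{SL}$ is the subvariety of $\mathcal I$ defined by $x' \approx x$ and $x \to y \approx y \to x$. $\mathcal{BA}$ is the subvariety of $\mathcal I$ defined by $(x\to y)\to x \approx x$ and $x \to x \approx 0'$. -}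

module Defs where

open import Level using (Level; 0ℓ) renaming (suc to lsuc)
open import Data.Fin using (Fin; zero; suc)
open import Data.Product using (_×_; _,_; Σ; ∃)
open import Data.Sum using (_⊎_)
open import Relation.Nullary using (¬_)
open import Relation.Binary.PropositionalEquality using (_≡_; _≢_)

record Zroupoid : Set₁ where
  infixr 5 _⇒_
  field
    Carrier : Set
    _⇒_ : Carrier → Carrier → Carrier
    𝟎 : Carrier

  _′ : Carrier → Carrier
  x ′ = x ⇒ 𝟎

  _∧_ : Carrier → Carrier → Carrier
  x ∧ y = (x ⇒ (y ′)) ′


Class : Set₂
Class = Zroupoid → Set₁

_⊆ᶜ_ : Class → Class → Set₁
K ⊆ᶜ L = ∀ A → K A → L A

_≐_ : Class → Class → Set₁
K ≐ L = (K ⊆ᶜ L) × (L ⊆ᶜ K)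

_⊂ᶜ_ : Class → Class → Set₁
K ⊂ᶜ L = (K ⊆ᶜ L) × Σ Zroupoid (λ A → L A × ¬ K A)

record Lift₁ (P : Set) : Set₁ where
  constructor lift₁
  field lower₁ : P

IsI : Class
IsI A = Lift₁ (
  (∀ x y z → (x ⇒ y) ⇒ z ≡ ((((z ′) ⇒ x) ⇒ ((y ⇒ z) ′)) ′))
  × ((𝟎 ′) ′ ≡ 𝟎))
  where open Zroupoid A

IsS : Class
IsS A = IsI A × Lift₁ ((∀ x → (x ′) ′ ≡ x) × (∀ x y → x ∧ y ≡ y ∧ x))
  where open Zroupoid A

IsSL : Class
IsSL A = IsI A × Lift₁ ((∀ x → x ′ ≡ x) × (∀ x y → x ⇒ y ≡ y ⇒ x))
  where open Zroupoid A

IsBA : Class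
IsBA A = IsI A × Lift₁ ((∀ x y → (x ⇒ y) ⇒ x ≡ x) × (∀ x → x ⇒ x ≡ 𝟎 ′))
  where open Zroupoid A

-- The identities (A1)–(A14); index k : Fin 14 stands for (A(k+1)).
Aid : Fin 14 → Zroupoid → Set
Aid zero A = ∀ x y z → x ⇒ (y ⇒ z) ≡ (x ⇒ y) ⇒ z where open Zroupoid A
Aid (suc zero) A = ∀ x y z → x ⇒ (y ⇒ z) ≡ x ⇒ (z ⇒ y) where open Zroupoid A
Aid (suc (suc zero)) A = ∀ x y z → x ⇒ (y ⇒ z) ≡ (x ⇒ z) ⇒ y where open Zroupoid A
Aid (suc (suc (suc zero))) A = ∀ x y z → x ⇒ (y ⇒ z) ≡ y ⇒ (x ⇒ z) where open Zroupoid A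
Aid (suc (suc (suc (suc zero)))) A = ∀ x y z → x ⇒ (y ⇒ z) ≡ (y ⇒ x) ⇒ z where open Zroupoid A
Aid (suc (suc (suc (suc (suc zero))))) A = ∀ x y z → x ⇒ (y ⇒ z) ≡ y ⇒ (z ⇒ x) where open Zroupoid A
Aid (suc (suc (suc (suc (suc (suc zero)))))) A = ∀ x y z → x ⇒ (y ⇒ z) ≡ (y ⇒ z) ⇒ x where open Zroupoid A
Aid (suc (suc (suc (suc (suc (suc (suc zero))))))) A = ∀ x y z → x ⇒ (y ⇒ z) ≡ (z ⇒ x) ⇒ y where open Zroupoid A
Aid (suc (suc (suc (suc (suc (suc (suc (suc zero)))))))) A = ∀ x y z → x ⇒ (y ⇒ z) ≡ z ⇒ (y ⇒ x) where open Zroupoid A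
Aid (suc (suc (suc (suc (suc (suc (suc (suc (suc zero))))))))) A = ∀ x y z → x ⇒ (y ⇒ z) ≡ (z ⇒ y) ⇒ x where open Zroupoid A
Aid (suc (suc (suc (suc (suc (suc (suc (suc (suc (suc zero)))))))))) A = ∀ x y z → (x ⇒ y) ⇒ z ≡ (x ⇒ z) ⇒ y where open Zroupoid A
Aid (suc (suc (suc (suc (suc (suc (suc (suc (suc (suc (suc zero))))))))))) A = ∀ x y z → (x ⇒ y) ⇒ z ≡ (y ⇒ x) ⇒ z where open Zroupoid A
Aid (suc (suc (suc (suc (suc (suc (suc (suc (suc (suc (suc (suc zero)))))))))))) A = ∀ x y z → (x ⇒ y) ⇒ z ≡ (y ⇒ z) ⇒ x where open Zroupoid A
Aid (suc (suc (suc (suc (suc (suc (suc (suc (suc (suc (suc (suc (suc zero))))))))))))) A = ∀ x y z → (x ⇒ y) ⇒ z ≡ (z ⇒ y) ⇒ x where open Zroupoid A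

IsA : Fin 14 → Class
IsA k A = IsI A × Lift₁ (Aid k A)

IsSi : Fin 14 → Class
IsSi k A = IsA k A × IsS A

IsS14 : Class
IsS14 = IsSi (suc (suc (suc (suc (suc (suc (suc (suc (suc (suc (suc (suc (suc zero)))))))))))))

data Var : Set where
  vx vy vz : Var

data Bracket : Set where
  right : Bracket   -- ⋆ → (⋆ → ⋆)
  left  : Bracket   -- (⋆ → ⋆) → ⋆

record AssocTerm : Set where
  constructor mkTerm
  field
    br : Bracket
    v₁ v₂ v₃ : Var
    d₁₂ : v₁ ≢ v₂
    d₁₃ : v₁ ≢ v₃
    d₂₃ : v₂ ≢ v₃

evalVar : {C : Set} → C → C → C → Var → C
evalVar a b c vx = a
evalVar a b c vy = b
evalVar a b c vz = c

eval : (A : Zroupoid) → AssocTerm → Zroupoid.Carrier A → Zroupoid.Carrier A → Zroupoid.Carrier A → Zroupoid.Carrier A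
eval A (mkTerm right v₁ v₂ v₃ _ _ _) a b c =
  Zroupoid._⇒_ A (evalVar a b c v₁) (Zroupoid._⇒_ A (evalVar a b c v₂) (evalVar a b c v₃))
eval A (mkTerm left v₁ v₂ v₃ _ _ _) a b c =
  Zroupoid._⇒_ A (Zroupoid._⇒_ A (evalVar a b c v₁) (evalVar a b c v₂)) (evalVar a b c v₃)

SDef : AssocTerm → AssocTerm → Class
SDef p q A = IsS A × Lift₁ (∀ a b c → eval A p a b c ≡ eval A q a b c)

IsAssocType : Class → Set₁
IsAssocType K = Σ AssocTerm (λ p → Σ AssocTerm (λ q → K ≐ SDef p q))

-- In a symmetric ℐ-zroupoid, x ⊔ y := x′ → y is commutative with unit 0 and distributes over its
-- De Morgan dual x ⊓ y := (x′ ⊔ y′)′.  These laws alone make ⊔ idempotent and associative: the map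
-- τ x := x ⊔ 0′ is a ⊔-homomorphism onto elements on which ⊔ and ⊓ agree, where distributivity
-- becomes associativity; and if x, y occur in each other (y ⊓ x ≈ τ y ⊓ x and x ⊓ y ≈ τ x ⊓ y),
-- as the two bracketings of x ⊔ y ⊔ z do, then τ x ≈ τ y already gives x ≈ y.
-- Hence x → (y → z) ≈ y → (x → z) holds in 𝒮, so right-bracketed terms with the same last variable
-- agree, while (x → y) → z ≈ (z → y) → x is (A14).  Every other identity of associative type,
-- evaluated with one variable sent to y and the others to 1 (or the reverse), specialises to
-- y → 1 ≈ y or to y → y ≈ y, and either forces x′ ≈ x, that is 𝒮ℒ.  The two-element Boolean
-- algebra lies in ℬ𝒜 ∩ 𝒮 but not in 𝒮₁₄, and a four-element model of (A14) is not in 𝒮ℒ.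

module Submission where

open import Defs
open import Algebra.Core using (Op₁; Op₂)
open import Data.Bool using (if_then_else_)
open import Function using (_∘_)
open import Data.Fin using (Fin; suc; #_)
open import Data.Fin.Patterns using (0F; 1F; 2F; 3F; 4F; 5F; 6F; 7F; 8F; 9F)
open import Data.Fin.Properties using (all?) renaming (_≟_ to _≟ᶠ_)
open import Data.Nat using (ℕ)
open import Data.Product using (_×_; _,_; Σ; proj₁; proj₂)
open import Data.Sum using (_⊎_; inj₁; inj₂)
open import Data.Vec using (Vec; []; _∷_; lookup)
open import Relation.Binary.Definitions using (DecidableEquality)
open import Relation.Binary.PropositionalEquality
open import Relation.Nullary using (¬_; Dec; yes; no; does)
open import Relation.Nullary.Decidable
  using (map′; ¬?; _×-dec_; _⊎-dec_; _→-dec_; from-yes; from-no; dec-true; dec-false)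
open ≡-Reasoning
open AssocTerm using (br; v₁; v₂; v₃)
open Lift₁ using (lower₁)

-- Commutative monoids with an involution, distributing over their De Morgan dual

module DeMorgan {C : Set} (join : Op₂ C) (complement : Op₁ C) where

  open import Algebra.Definitions (_≡_ {A = C})

  infixl 6 _⊔_
  infixl 7 _⊓_
  infix 8 _ᶜ

  _⊔_ : Op₂ C
  _⊔_ = join

  _ᶜ : Op₁ C
  _ᶜ = complement

  _⊓_ : Op₂ C
  x ⊓ y = (x ᶜ ⊔ y ᶜ) ᶜ

  module Properties
    (𝟘 : C)
    (ᶜ-involutive : Involutive _ᶜ)
    (⊔-identityˡ : LeftIdentity 𝟘 _⊔_)
    (⊔-comm : Commutative _⊔_)
    (⊔-distribʳ-⊓ : _⊔_ DistributesOverʳ _⊓_)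
    where

    𝟙 : C
    𝟙 = 𝟘 ᶜ

    τ σ : Op₁ C
    τ x = x ⊔ 𝟙
    σ x = x ⊓ 𝟘

    ᶜ-⊔ : ∀ x y → (x ⊔ y) ᶜ ≡ x ᶜ ⊓ y ᶜ
    ᶜ-⊔ x y = cong _ᶜ (sym (cong₂ _⊔_ (ᶜ-involutive x) (ᶜ-involutive y)))

    ᶜ-⊓ : ∀ x y → (x ⊓ y) ᶜ ≡ x ᶜ ⊔ y ᶜ
    ᶜ-⊓ x y = ᶜ-involutive (x ᶜ ⊔ y ᶜ)

    ⊓-comm : Commutative _⊓_
    ⊓-comm x y = cong _ᶜ (⊔-comm (x ᶜ) (y ᶜ))

    ⊓-identityˡ : LeftIdentity 𝟙 _⊓_
    ⊓-identityˡ x = begin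
      (𝟘 ᶜ ᶜ ⊔ x ᶜ) ᶜ  ≡⟨ cong (λ t → (t ⊔ x ᶜ) ᶜ) (ᶜ-involutive 𝟘) ⟩
      (𝟘 ⊔ x ᶜ) ᶜ      ≡⟨ cong _ᶜ (⊔-identityˡ (x ᶜ)) ⟩
      x ᶜ ᶜ            ≡⟨ ᶜ-involutive x ⟩
      x                ∎

    ⊓-identityʳ : RightIdentity 𝟙 _⊓_
    ⊓-identityʳ x = trans (⊓-comm x 𝟙) (⊓-identityˡ x)

    ⊓-distribʳ-⊔ : _⊓_ DistributesOverʳ _⊔_
    ⊓-distribʳ-⊔ x y z = begin
      ((y ⊔ z) ᶜ ⊔ x ᶜ) ᶜ            ≡⟨ cong (λ t → (t ⊔ x ᶜ) ᶜ) (ᶜ-⊔ y z) ⟩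
      (y ᶜ ⊓ z ᶜ ⊔ x ᶜ) ᶜ            ≡⟨ cong _ᶜ (⊔-distribʳ-⊓ (x ᶜ) (y ᶜ) (z ᶜ)) ⟩
      ((y ᶜ ⊔ x ᶜ) ⊓ (z ᶜ ⊔ x ᶜ)) ᶜ  ≡⟨ ᶜ-⊓ _ _ ⟩
      y ⊓ x ⊔ z ⊓ x                  ∎

    ⊓-absorbs-τ : ∀ x → x ⊓ τ x ≡ x
    ⊓-absorbs-τ x = begin
      x ⊓ τ x            ≡⟨ cong₂ _⊓_ (sym (⊔-identityˡ x)) (⊔-comm x 𝟙) ⟩
      (𝟘 ⊔ x) ⊓ (𝟙 ⊔ x)  ≡⟨ sym (⊔-distribʳ-⊓ x 𝟘 𝟙) ⟩
      𝟘 ⊓ 𝟙 ⊔ x          ≡⟨ cong (_⊔ x) (⊓-identityʳ 𝟘) ⟩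
      𝟘 ⊔ x              ≡⟨ ⊔-identityˡ x ⟩
      x                  ∎

    τ-𝟙 : τ 𝟙 ≡ 𝟙
    τ-𝟙 = trans (sym (⊓-identityˡ (τ 𝟙))) (⊓-absorbs-τ 𝟙)

    ⊓-idem : Idempotent _⊓_
    ⊓-idem x = begin
      x ⊓ x              ≡⟨ sym (cong₂ _⊓_ (⊔-identityˡ x) (⊔-identityˡ x)) ⟩
      (𝟘 ⊔ x) ⊓ (𝟘 ⊔ x)  ≡⟨ sym (⊔-distribʳ-⊓ x 𝟘 𝟘) ⟩
      𝟘 ⊓ 𝟘 ⊔ x          ≡⟨ cong (λ t → t ᶜ ⊔ x) τ-𝟙 ⟩
      𝟘 ᶜ ᶜ ⊔ x          ≡⟨ cong (_⊔ x) (ᶜ-involutive 𝟘) ⟩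
      𝟘 ⊔ x              ≡⟨ ⊔-identityˡ x ⟩
      x                  ∎

    ⊔-idem : Idempotent _⊔_
    ⊔-idem x = begin
      x ⊔ x        ≡⟨ sym (ᶜ-involutive (x ⊔ x)) ⟩
      (x ⊔ x) ᶜ ᶜ  ≡⟨ cong _ᶜ (trans (ᶜ-⊔ x x) (⊓-idem (x ᶜ))) ⟩
      x ᶜ ᶜ        ≡⟨ ᶜ-involutive x ⟩
      x            ∎

    τ⊓≡⊓⊔ : ∀ x y → τ y ⊓ x ≡ x ⊓ y ⊔ x
    τ⊓≡⊓⊔ x y = begin
      (y ⊔ 𝟙) ⊓ x    ≡⟨ ⊓-distribʳ-⊔ x y 𝟙 ⟩
      y ⊓ x ⊔ 𝟙 ⊓ x  ≡⟨ cong₂ _⊔_ (⊓-comm y x) (⊓-identityˡ x) ⟩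
      x ⊓ y ⊔ x      ∎

    σ⊔≡⊓⊔ : ∀ x y → σ y ⊔ x ≡ x ⊓ y ⊔ x
    σ⊔≡⊓⊔ x y = begin
      y ⊓ 𝟘 ⊔ x          ≡⟨ ⊔-distribʳ-⊓ x y 𝟘 ⟩
      (y ⊔ x) ⊓ (𝟘 ⊔ x)  ≡⟨ cong ((y ⊔ x) ⊓_) (⊔-identityˡ x) ⟩
      (y ⊔ x) ⊓ x        ≡⟨ ⊓-comm (y ⊔ x) x ⟩
      x ⊓ (y ⊔ x)        ≡⟨ cong (_⊓ (y ⊔ x)) (sym (⊔-idem x)) ⟩
      (x ⊔ x) ⊓ (y ⊔ x)  ≡⟨ sym (⊔-distribʳ-⊓ x x y) ⟩
      x ⊓ y ⊔ x          ∎

    τ⊓≡σ⊔ : ∀ x y → τ y ⊓ x ≡ σ y ⊔ x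
    τ⊓≡σ⊔ x y = trans (τ⊓≡⊓⊔ x y) (sym (σ⊔≡⊓⊔ x y))

    τ∘σ : ∀ x → τ (σ x) ≡ τ x
    τ∘σ x = trans (sym (τ⊓≡σ⊔ 𝟙 x)) (⊓-identityʳ (τ x))

    σ∘τ : ∀ x → σ (τ x) ≡ σ x
    σ∘τ x = trans (τ⊓≡σ⊔ 𝟘 x) (trans (⊔-comm (σ x) 𝟘) (⊔-identityˡ (σ x)))

    τ-idem : IdempotentFun τ
    τ-idem x = begin
      τ (τ x)      ≡⟨ sym (τ∘σ (τ x)) ⟩
      τ (σ (τ x))  ≡⟨ cong τ (σ∘τ x) ⟩
      τ (σ x)      ≡⟨ τ∘σ x ⟩
      τ x          ∎

    ⊔⊓τ : ∀ x y → (x ⊔ y) ⊓ τ y ≡ x ⊔ y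
    ⊔⊓τ x y = begin
      (x ⊔ y) ⊓ τ y        ≡⟨ cong ((x ⊔ y) ⊓_) (⊔-comm y 𝟙) ⟩
      (x ⊔ y) ⊓ (𝟙 ⊔ y)    ≡⟨ sym (⊔-distribʳ-⊓ y x 𝟙) ⟩
      x ⊓ 𝟙 ⊔ y            ≡⟨ cong (_⊔ y) (⊓-identityʳ x) ⟩
      x ⊔ y                ∎

    τ⊓⊔τ : ∀ x y → τ y ⊓ x ⊔ τ y ≡ x ⊔ τ y
    τ⊓⊔τ x y = begin
      τ y ⊓ x ⊔ τ y            ≡⟨ ⊔-distribʳ-⊓ (τ y) (τ y) x ⟩
      (τ y ⊔ τ y) ⊓ (x ⊔ τ y)  ≡⟨ cong (_⊓ (x ⊔ τ y)) (⊔-idem (τ y)) ⟩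
      τ y ⊓ (x ⊔ τ y)          ≡⟨ ⊓-comm (τ y) (x ⊔ τ y) ⟩
      (x ⊔ τ y) ⊓ τ y          ≡⟨ cong ((x ⊔ τ y) ⊓_) (sym (τ-idem y)) ⟩
      (x ⊔ τ y) ⊓ τ (τ y)      ≡⟨ ⊔⊓τ x (τ y) ⟩
      x ⊔ τ y                  ∎

    τ-⊓-homo : ∀ x y → τ (x ⊓ y) ≡ τ x ⊓ τ y
    τ-⊓-homo = ⊔-distribʳ-⊓ 𝟙

    τ-⊓≡⊔τ : ∀ x y → τ (x ⊓ y) ≡ x ⊔ τ y
    τ-⊓≡⊔τ x y = begin
      τ (x ⊓ y)      ≡⟨ τ-⊓-homo x y ⟩
      τ x ⊓ τ y      ≡⟨ τ⊓≡⊓⊔ (τ y) x ⟩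
      τ y ⊓ x ⊔ τ y  ≡⟨ τ⊓⊔τ x y ⟩
      x ⊔ τ y        ∎

    τᶜ : ∀ x → τ x ᶜ ≡ σ (x ᶜ)
    τᶜ x = cong (λ t → (t ⊔ 𝟙) ᶜ) (sym (ᶜ-involutive x))

    σ-⊔≡⊓σ : ∀ x y → σ (x ⊔ y) ≡ x ⊓ σ y
    σ-⊔≡⊓σ x y = begin
      σ (x ⊔ y)              ≡⟨ cong σ (sym (ᶜ-involutive (x ⊔ y))) ⟩
      σ ((x ⊔ y) ᶜ ᶜ)        ≡⟨ sym (τᶜ ((x ⊔ y) ᶜ)) ⟩
      τ ((x ⊔ y) ᶜ) ᶜ        ≡⟨ cong (λ t → τ t ᶜ) (ᶜ-⊔ x y) ⟩
      τ (x ᶜ ⊓ y ᶜ) ᶜ        ≡⟨ cong _ᶜ (τ-⊓≡⊔τ (x ᶜ) (y ᶜ)) ⟩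
      (x ᶜ ⊔ τ (y ᶜ)) ᶜ      ≡⟨ ᶜ-⊔ (x ᶜ) (τ (y ᶜ)) ⟩
      x ᶜ ᶜ ⊓ τ (y ᶜ) ᶜ      ≡⟨ cong₂ _⊓_ (ᶜ-involutive x) (τᶜ (y ᶜ)) ⟩
      x ⊓ σ (y ᶜ ᶜ)          ≡⟨ cong (λ t → x ⊓ σ t) (ᶜ-involutive y) ⟩
      x ⊓ σ y                ∎

    τ-⊔≡⊔τ : ∀ x y → τ (x ⊔ y) ≡ x ⊔ τ y
    τ-⊔≡⊔τ x y = begin
      τ (x ⊔ y)        ≡⟨ sym (τ∘σ (x ⊔ y)) ⟩
      τ (σ (x ⊔ y))    ≡⟨ cong τ (σ-⊔≡⊓σ x y) ⟩
      τ (x ⊓ σ y)      ≡⟨ τ-⊓≡⊔τ x (σ y) ⟩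
      x ⊔ τ (σ y)      ≡⟨ cong (x ⊔_) (τ∘σ y) ⟩
      x ⊔ τ y          ∎

    τ-⊔-homo : ∀ x y → τ (x ⊔ y) ≡ τ x ⊔ τ y
    τ-⊔-homo x y = begin
      τ (x ⊔ y)        ≡⟨ cong τ (⊔-comm x y) ⟩
      τ (y ⊔ x)        ≡⟨ sym (τ-idem (y ⊔ x)) ⟩
      τ (τ (y ⊔ x))    ≡⟨ cong τ (trans (τ-⊔≡⊔τ y x) (⊔-comm y (τ x))) ⟩
      τ (τ x ⊔ y)      ≡⟨ τ-⊔≡⊔τ (τ x) y ⟩
      τ x ⊔ τ y        ∎

    τ⊓τ≡τ⊔τ : ∀ x y → τ x ⊓ τ y ≡ τ x ⊔ τ y
    τ⊓τ≡τ⊔τ x y = begin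
      τ x ⊓ τ y    ≡⟨ sym (τ-⊓-homo x y) ⟩
      τ (x ⊓ y)    ≡⟨ τ-⊓≡⊔τ x y ⟩
      x ⊔ τ y      ≡⟨ sym (τ-⊔≡⊔τ x y) ⟩
      τ (x ⊔ y)    ≡⟨ τ-⊔-homo x y ⟩
      τ x ⊔ τ y    ∎

    τ-selfdistrib : ∀ x y z → (τ x ⊔ τ z) ⊔ (τ y ⊔ τ z) ≡ (τ x ⊔ τ y) ⊔ τ z
    τ-selfdistrib x y z = begin
      (τ x ⊔ τ z) ⊔ (τ y ⊔ τ z)  ≡⟨ sym (cong₂ _⊔_ (τ-⊔-homo x z) (τ-⊔-homo y z)) ⟩
      τ (x ⊔ z) ⊔ τ (y ⊔ z)      ≡⟨ sym (τ⊓τ≡τ⊔τ (x ⊔ z) (y ⊔ z)) ⟩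
      τ (x ⊔ z) ⊓ τ (y ⊔ z)      ≡⟨ sym (τ-⊓-homo (x ⊔ z) (y ⊔ z)) ⟩
      τ ((x ⊔ z) ⊓ (y ⊔ z))      ≡⟨ cong τ (sym (⊔-distribʳ-⊓ z x y)) ⟩
      τ (x ⊓ y ⊔ z)              ≡⟨ τ-⊔-homo (x ⊓ y) z ⟩
      τ (x ⊓ y) ⊔ τ z            ≡⟨ cong (_⊔ τ z) (trans (τ-⊓-homo x y) (τ⊓τ≡τ⊔τ x y)) ⟩
      (τ x ⊔ τ y) ⊔ τ z          ∎

    τ-⊔-absorb : ∀ x y → τ y ⊔ τ (x ⊔ y) ≡ τ (x ⊔ y)
    τ-⊔-absorb x y = begin
      τ y ⊔ τ (x ⊔ y)            ≡⟨ cong₂ _⊔_ (sym (τ-𝟘⊔ y)) (τ-⊔-homo x y) ⟩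
      (τ 𝟘 ⊔ τ y) ⊔ (τ x ⊔ τ y)  ≡⟨ τ-selfdistrib 𝟘 x y ⟩
      (τ 𝟘 ⊔ τ x) ⊔ τ y          ≡⟨ cong (_⊔ τ y) (τ-𝟘⊔ x) ⟩
      τ x ⊔ τ y                  ≡⟨ sym (τ-⊔-homo x y) ⟩
      τ (x ⊔ y)                  ∎
      where
      τ-𝟘⊔ : ∀ w → τ 𝟘 ⊔ τ w ≡ τ w
      τ-𝟘⊔ w = trans (sym (τ-⊔-homo 𝟘 w)) (cong τ (⊔-identityˡ w))

    τ-assoc : ∀ x y z → τ (x ⊔ y ⊔ z) ≡ τ (x ⊔ (y ⊔ z))
    τ-assoc x y z = begin
      τ (x ⊔ y ⊔ z)                        ≡⟨ τ-⊔-homo (x ⊔ y) z ⟩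
      τ (x ⊔ y) ⊔ τ z                      ≡⟨ cong (_⊔ τ z) (τ-⊔-homo x y) ⟩
      τ x ⊔ τ y ⊔ τ z                      ≡⟨ sym (τ-selfdistrib x y z) ⟩
      (τ x ⊔ τ z) ⊔ (τ y ⊔ τ z)            ≡⟨ cong₂ _⊔_ (⊔-comm (τ x) (τ z)) (sym (τ-⊔-homo y z)) ⟩
      (τ z ⊔ τ x) ⊔ τ (y ⊔ z)              ≡⟨ sym (τ-selfdistrib z x (y ⊔ z)) ⟩
      τ z ⊔ τ (y ⊔ z) ⊔ (τ x ⊔ τ (y ⊔ z))  ≡⟨ cong₂ _⊔_ (τ-⊔-absorb y z) (sym (τ-⊔-homo x (y ⊔ z))) ⟩
      τ (y ⊔ z) ⊔ τ (x ⊔ (y ⊔ z))          ≡⟨ τ-⊔-absorb x (y ⊔ z) ⟩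
      τ (x ⊔ (y ⊔ z))                      ∎

    _occursIn_ : C → C → Set
    x occursIn y = y ⊓ x ≡ τ y ⊓ x

    occursIn-refl : ∀ x → x occursIn x
    occursIn-refl x = trans (⊓-idem x) (sym (trans (⊓-comm (τ x) x) (⊓-absorbs-τ x)))

    occursIn-⊔ʳ : ∀ {x y} z → x occursIn y → x occursIn (y ⊔ z)
    occursIn-⊔ʳ {x} {y} z x∈y = begin
      (y ⊔ z) ⊓ x        ≡⟨ ⊓-distribʳ-⊔ x y z ⟩
      y ⊓ x ⊔ z ⊓ x      ≡⟨ cong (_⊔ z ⊓ x) x∈y ⟩
      τ y ⊓ x ⊔ z ⊓ x    ≡⟨ sym (⊓-distribʳ-⊔ x (τ y) z) ⟩
      (τ y ⊔ z) ⊓ x      ≡⟨ cong (_⊓ x) (trans (⊔-comm (τ y) z) (sym (τ-⊔≡⊔τ z y))) ⟩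
      τ (z ⊔ y) ⊓ x      ≡⟨ cong (λ t → τ t ⊓ x) (⊔-comm z y) ⟩
      τ (y ⊔ z) ⊓ x      ∎

    occursIn-⊔ˡ : ∀ {x y} z → x occursIn y → x occursIn (z ⊔ y)
    occursIn-⊔ˡ {x} {y} z x∈y = subst (x occursIn_) (⊔-comm y z) (occursIn-⊔ʳ z x∈y)

    ⊔-occursIn : ∀ {x y z} → x occursIn z → y occursIn z → (x ⊔ y) occursIn z
    ⊔-occursIn {x} {y} {z} x∈z y∈z = begin
      z ⊓ (x ⊔ y)          ≡⟨ ⊓-comm z (x ⊔ y) ⟩
      (x ⊔ y) ⊓ z          ≡⟨ ⊓-distribʳ-⊔ z x y ⟩
      x ⊓ z ⊔ y ⊓ z        ≡⟨ cong₂ _⊔_ (trans (⊓-comm x z) x∈z) (trans (⊓-comm y z) y∈z) ⟩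
      τ z ⊓ x ⊔ τ z ⊓ y    ≡⟨ cong₂ _⊔_ (⊓-comm (τ z) x) (⊓-comm (τ z) y) ⟩
      x ⊓ τ z ⊔ y ⊓ τ z    ≡⟨ sym (⊓-distribʳ-⊔ (τ z) x y) ⟩
      (x ⊔ y) ⊓ τ z        ≡⟨ ⊓-comm (x ⊔ y) (τ z) ⟩
      τ z ⊓ (x ⊔ y)        ∎

    occursIn-antisym : ∀ {x y} → x occursIn y → y occursIn x → τ x ≡ τ y → x ≡ y
    occursIn-antisym {x} {y} x∈y y∈x τx≡τy = begin
      x          ≡⟨ sym (trans (⊓-comm (τ x) x) (⊓-absorbs-τ x)) ⟩
      τ x ⊓ x    ≡⟨ cong (_⊓ x) τx≡τy ⟩
      τ y ⊓ x    ≡⟨ sym x∈y ⟩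
      y ⊓ x      ≡⟨ ⊓-comm y x ⟩
      x ⊓ y      ≡⟨ y∈x ⟩
      τ x ⊓ y    ≡⟨ cong (_⊓ y) τx≡τy ⟩
      τ y ⊓ y    ≡⟨ trans (⊓-comm (τ y) y) (⊓-absorbs-τ y) ⟩
      y          ∎

    ⊔-assoc : Associative _⊔_
    ⊔-assoc x y z = occursIn-antisym left∈right right∈left (τ-assoc x y z)
      where
      left∈right : (x ⊔ y ⊔ z) occursIn (x ⊔ (y ⊔ z))
      left∈right = ⊔-occursIn (⊔-occursIn (occursIn-⊔ʳ (y ⊔ z) (occursIn-refl x))
                                          (occursIn-⊔ˡ x (occursIn-⊔ʳ z (occursIn-refl y))))
                              (occursIn-⊔ˡ x (occursIn-⊔ˡ y (occursIn-refl z)))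
      right∈left : (x ⊔ (y ⊔ z)) occursIn (x ⊔ y ⊔ z)
      right∈left = ⊔-occursIn (occursIn-⊔ʳ z (occursIn-⊔ʳ y (occursIn-refl x)))
                              (⊔-occursIn (occursIn-⊔ʳ z (occursIn-⊔ˡ x (occursIn-refl y)))
                                          (occursIn-⊔ˡ (x ⊔ y) (occursIn-refl z)))

    σ⊔-absorb : ∀ x → σ x ⊔ x ≡ x
    σ⊔-absorb x = trans (sym (τ⊓≡σ⊔ x x)) (trans (⊓-comm (τ x) x) (⊓-absorbs-τ x))

-- Symmetric ℐ-zroupoids

module Symmetric (A : Zroupoid) (isS : IsS A) where

  open Zroupoid A
  open import Algebra.Definitions (_≡_ {A = Carrier}) using (Involutive)

  I-law : ∀ x y z → (x ⇒ y) ⇒ z ≡ ((z ′ ⇒ x) ⇒ (y ⇒ z) ′) ′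
  I-law = proj₁ (lower₁ (proj₁ isS))

  ′-involutive : Involutive _′
  ′-involutive = proj₁ (lower₁ (proj₂ isS))

  ∧-comm : ∀ x y → x ∧ y ≡ y ∧ x
  ∧-comm = proj₂ (lower₁ (proj₂ isS))

  ⇒′-comm : ∀ x y → x ⇒ y ′ ≡ y ⇒ x ′
  ⇒′-comm x y = begin
    x ⇒ y ′          ≡⟨ sym (′-involutive (x ⇒ y ′)) ⟩
    (x ∧ y) ′        ≡⟨ cong _′ (∧-comm x y) ⟩
    (y ∧ x) ′        ≡⟨ ′-involutive (y ⇒ x ′) ⟩
    y ⇒ x ′          ∎

  contraposition : ∀ x y → x ⇒ y ≡ y ′ ⇒ x ′
  contraposition x y = trans (cong (x ⇒_) (sym (′-involutive y))) (⇒′-comm x (y ′))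

  open DeMorgan (λ x y → x ′ ⇒ y) _′ public

  ⊔-comm : ∀ x y → x ⊔ y ≡ y ⊔ x
  ⊔-comm x y = trans (contraposition (x ′) y) (cong (y ′ ⇒_) (′-involutive x))

  ⊔-identityˡ : ∀ x → 𝟎 ⊔ x ≡ x
  ⊔-identityˡ x = begin
    𝟎 ′ ⇒ x                    ≡⟨ sym (′-involutive (𝟎 ′ ⇒ x)) ⟩
    ((𝟎 ′ ⇒ x) ⇒ 𝟎) ′          ≡⟨ cong (λ t → ((𝟎 ′ ⇒ x) ⇒ t) ′) (sym (′-involutive 𝟎)) ⟩
    ((𝟎 ′ ⇒ x) ⇒ (𝟎 ⇒ 𝟎) ′) ′  ≡⟨ sym (I-law x 𝟎 𝟎) ⟩
    x ′ ′                      ≡⟨ ′-involutive x ⟩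
    x                          ∎

  ⊔-distribʳ-⊓ : ∀ x y z → y ⊓ z ⊔ x ≡ (y ⊔ x) ⊓ (z ⊔ x)
  ⊔-distribʳ-⊓ x y z = begin
    (y ′ ′ ⇒ z ′) ′ ′ ⇒ x            ≡⟨ cong (_⇒ x) (′-involutive _) ⟩
    (y ′ ′ ⇒ z ′) ⇒ x                ≡⟨ cong (λ t → (t ⇒ z ′) ⇒ x) (′-involutive y) ⟩
    (y ⇒ z ′) ⇒ x                    ≡⟨ I-law y (z ′) x ⟩
    ((x ′ ⇒ y) ⇒ (z ′ ⇒ x) ′) ′      ≡⟨ cong (λ t → (t ⇒ (z ′ ⇒ x) ′) ′) (⊔-comm x y) ⟩
    ((y ′ ⇒ x) ⇒ (z ′ ⇒ x) ′) ′      ≡⟨ cong (λ t → (t ⇒ (z ′ ⇒ x) ′) ′) (sym (′-involutive _)) ⟩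
    ((y ′ ⇒ x) ′ ′ ⇒ (z ′ ⇒ x) ′) ′  ∎

  open Properties 𝟎 ′-involutive ⊔-identityˡ ⊔-comm ⊔-distribʳ-⊓ public

  ⇒-as-⊔ : ∀ x y → x ⇒ y ≡ x ′ ⊔ y
  ⇒-as-⊔ x y = cong (_⇒ y) (sym (′-involutive x))

  ⇒-identityˡ : ∀ x → 𝟙 ⇒ x ≡ x
  ⇒-identityˡ = ⊔-identityˡ

  ⇒-exchange : ∀ x y z → x ⇒ (y ⇒ z) ≡ y ⇒ (x ⇒ z)
  ⇒-exchange x y z = begin
    x ⇒ (y ⇒ z)        ≡⟨ trans (⇒-as-⊔ x (y ⇒ z)) (cong (x ′ ⊔_) (⇒-as-⊔ y z)) ⟩
    x ′ ⊔ (y ′ ⊔ z)    ≡⟨ sym (⊔-assoc (x ′) (y ′) z) ⟩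
    x ′ ⊔ y ′ ⊔ z      ≡⟨ cong (_⊔ z) (⊔-comm (x ′) (y ′)) ⟩
    y ′ ⊔ x ′ ⊔ z      ≡⟨ ⊔-assoc (y ′) (x ′) z ⟩
    y ′ ⊔ (x ′ ⊔ z)    ≡⟨ sym (trans (⇒-as-⊔ y (x ⇒ z)) (cong (y ′ ⊔_) (⇒-as-⊔ x z))) ⟩
    y ⇒ (x ⇒ z)        ∎

  ⇒𝟙⇒-absorb : ∀ x → (x ⇒ 𝟙) ⇒ x ≡ x
  ⇒𝟙⇒-absorb x = begin
    (x ⇒ 𝟙) ⇒ x        ≡⟨ ⇒-as-⊔ (x ⇒ 𝟙) x ⟩
    (x ⇒ 𝟙) ′ ⊔ x      ≡⟨ cong (λ t → t ′ ⊔ x) (⇒-as-⊔ x 𝟙) ⟩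
    σ x ⊔ x            ≡⟨ σ⊔-absorb x ⟩
    x                  ∎

  ⇒𝟙≡id⇒′≡id : (∀ x → x ⇒ 𝟙 ≡ x) → ∀ x → x ′ ≡ x
  ⇒𝟙≡id⇒′≡id x⇒𝟙≡x x = trans (cong (x ⇒_) (sym 𝟙≡𝟎)) (x⇒𝟙≡x x)
    where
    𝟙≡𝟎 : 𝟙 ≡ 𝟎
    𝟙≡𝟎 = trans (sym τ-𝟙) (trans (sym (⇒-as-⊔ 𝟎 𝟙)) (x⇒𝟙≡x 𝟎))

  ⇒-idem⇒′≡id : (∀ x → x ⇒ x ≡ x) → ∀ x → x ′ ≡ x
  ⇒-idem⇒′≡id x⇒x≡x x = trans (sym (x⇒x≡x (x ′))) (trans (sym (contraposition x x)) (x⇒x≡x x))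

  ′≡id⇒IsSL : (∀ x → x ′ ≡ x) → IsSL A
  ′≡id⇒IsSL x′≡x = proj₁ isS , lift₁ (x′≡x , ⇒-comm)
    where
    ⇒-comm : ∀ x y → x ⇒ y ≡ y ⇒ x
    ⇒-comm x y = begin
      x ⇒ y      ≡⟨ cong (_⇒ y) (sym (x′≡x x)) ⟩
      x ′ ⇒ y    ≡⟨ ⊔-comm x y ⟩
      y ′ ⇒ x    ≡⟨ cong (_⇒ x) (x′≡x y) ⟩
      y ⇒ x      ∎

SL⊆S : IsSL ⊆ᶜ IsS
SL⊆S A (isI , lift₁ (x′≡x , ⇒-comm)) =
  isI , lift₁ ((λ x → trans (x′≡x (x ′)) (x′≡x x)) , λ x y → cong _′ (⇒′-comm x y))
  where
  open Zroupoid A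
  ⇒′-comm : ∀ x y → x ⇒ y ′ ≡ y ⇒ x ′
  ⇒′-comm x y = trans (cong (x ⇒_) (x′≡x y)) (trans (⇒-comm x y) (cong (y ⇒_) (sym (x′≡x x))))

_≟ᵥ_ : DecidableEquality Var
vx ≟ᵥ vx = yes refl
vx ≟ᵥ vy = no λ ()
vx ≟ᵥ vz = no λ ()
vy ≟ᵥ vx = no λ ()
vy ≟ᵥ vy = yes refl
vy ≟ᵥ vz = no λ ()
vz ≟ᵥ vx = no λ ()
vz ≟ᵥ vy = no λ ()
vz ≟ᵥ vz = yes refl

Distinct : Var → Var → Var → Set
Distinct a b c = a ≢ b × a ≢ c × b ≢ c

private
  ∀ᵥ? : {P : Var → Set} → (∀ v → Dec (P v)) → Dec (∀ v → P v)
  ∀ᵥ? P? = map′ (λ (px , py , pz) → λ { vx → px ; vy → py ; vz → pz })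
                (λ ∀P → ∀P vx , ∀P vy , ∀P vz)
                (P? vx ×-dec P? vy ×-dec P? vz)

  distinct? : ∀ a b c → Dec (Distinct a b c)
  distinct? a b c = ¬? (a ≟ᵥ b) ×-dec ¬? (a ≟ᵥ c) ×-dec ¬? (b ≟ᵥ c)

-- Opaque, so that with-abstraction over these proofs does not unfold the exhaustive check.
opaque
  not-last : ∀ {a b c w} → Distinct a b c → w ≢ c → w ≡ a ⊎ w ≡ b
  not-last {a} {b} {c} {w} = from-yes
    (∀ᵥ? λ a → ∀ᵥ? λ b → ∀ᵥ? λ c → ∀ᵥ? λ w →
      distinct? a b c →-dec ¬? (w ≟ᵥ c) →-dec (w ≟ᵥ a ⊎-dec w ≟ᵥ b))
    a b c w

  same-last : ∀ {a b a′ b′ c} → Distinct a b c → Distinct a′ b′ c → (a′ ≡ a × b′ ≡ b) ⊎ (a′ ≡ b × b′ ≡ a)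
  same-last {a} {b} {a′} {b′} {c} = from-yes
    (∀ᵥ? λ a → ∀ᵥ? λ b → ∀ᵥ? λ a′ → ∀ᵥ? λ b′ → ∀ᵥ? λ c →
      distinct? a b c →-dec distinct? a′ b′ c →-dec
      ((a′ ≟ᵥ a ×-dec b′ ≟ᵥ b) ⊎-dec (a′ ≟ᵥ b ×-dec b′ ≟ᵥ a)))
    a b a′ b′ c

  mirror-forced : ∀ {a b c a′ b′ c′} → Distinct a b c → Distinct a′ b′ c′ →
                  c ≢ c′ → c ≢ b′ → c′ ≢ b → a′ ≡ c × b′ ≡ b × c′ ≡ a
  mirror-forced {a} {b} {c} {a′} {b′} {c′} = from-yes
    (∀ᵥ? λ a → ∀ᵥ? λ b → ∀ᵥ? λ c → ∀ᵥ? λ a′ → ∀ᵥ? λ b′ → ∀ᵥ? λ c′ →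
      distinct? a b c →-dec distinct? a′ b′ c′ →-dec
      ¬? (c ≟ᵥ c′) →-dec ¬? (c ≟ᵥ b′) →-dec ¬? (c′ ≟ᵥ b) →-dec
      (a′ ≟ᵥ c ×-dec b′ ≟ᵥ b ×-dec c′ ≟ᵥ a))
    a b c a′ b′ c′

module _ {C : Set} (R : C → C → C → C) (R-swap₁₂ : ∀ a b c → R a b c ≡ R b a c) (f : Var → C) where

  R-same-last : ∀ {a b a′ b′ c} → Distinct a b c → Distinct a′ b′ c →
                R (f a) (f b) (f c) ≡ R (f a′) (f b′) (f c)
  R-same-last dabc da′b′c with same-last dabc da′b′c
  ... | inj₁ (refl , refl) = refl
  ... | inj₂ (refl , refl) = R-swap₁₂ _ _ _

  R-rearrange : (∀ a b c → R a b c ≡ R a c b) →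
                ∀ {a b c a′ b′ c′} → Distinct a b c → Distinct a′ b′ c′ →
                R (f a) (f b) (f c) ≡ R (f a′) (f b′) (f c′)
  R-rearrange R-swap₂₃ {c = c} {c′ = c′} dabc da′b′c′@(da′b′ , da′c′ , db′c′) with c ≟ᵥ c′
  ... | yes refl = R-same-last dabc da′b′c′
  ... | no c≢c′ with not-last da′b′c′ c≢c′
  ...   | inj₁ refl = trans (R-same-last dabc (db′c′ , da′b′ ∘ sym , da′c′ ∘ sym))
                            (trans (sym (R-swap₂₃ _ _ _)) (sym (R-swap₁₂ _ _ _)))
  ...   | inj₂ refl = trans (R-same-last dabc (da′c′ , da′b′ , db′c′ ∘ sym)) (sym (R-swap₂₃ _ _ _))

_[_↦_] : {C : Set} → (Var → C) → Var → C → Var → C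
(f [ v ↦ a ]) w = if does (w ≟ᵥ v) then a else f w

[↦]-≡ : ∀ {C : Set} (f : Var → C) v a → (f [ v ↦ a ]) v ≡ a
[↦]-≡ f v a rewrite dec-true (v ≟ᵥ v) refl = refl

[↦]-≢ : ∀ {C : Set} (f : Var → C) {v w} a → w ≢ v → (f [ v ↦ a ]) w ≡ f w
[↦]-≢ f {v} {w} a w≢v rewrite dec-false (w ≟ᵥ v) w≢v = refl

assign : ∀ {C : Set} {u v w} → Distinct u v w → C → C → C → Var → C
assign {u = u} {v} _ x y z = ((λ _ → z) [ v ↦ y ]) [ u ↦ x ]

module _ {C : Set} {u v w} (d : Distinct u v w) {x y z : C} where

  assign-₁ : assign d x y z u ≡ x
  assign-₁ = [↦]-≡ ((λ _ → z) [ v ↦ y ]) u x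

  assign-₂ : assign d x y z v ≡ y
  assign-₂ = trans ([↦]-≢ ((λ _ → z) [ v ↦ y ]) x (proj₁ d ∘ sym)) ([↦]-≡ (λ _ → z) v y)

  assign-₃ : assign d x y z w ≡ z
  assign-₃ = trans ([↦]-≢ ((λ _ → z) [ v ↦ y ]) x (proj₁ (proj₂ d) ∘ sym))
                   ([↦]-≢ (λ _ → z) y (proj₂ (proj₂ d) ∘ sym))

-- Identities of associative type

R⟨_⟩ L⟨_⟩ : ∀ {u v w} → Distinct u v w → AssocTerm
R⟨ d₁₂ , d₁₃ , d₂₃ ⟩ = mkTerm right _ _ _ d₁₂ d₁₃ d₂₃
L⟨ d₁₂ , d₁₃ , d₂₃ ⟩ = mkTerm left _ _ _ d₁₂ d₁₃ d₂₃

distinct : (t : AssocTerm) → Distinct (v₁ t) (v₂ t) (v₃ t)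
distinct (mkTerm _ _ _ _ d₁₂ d₁₃ d₂₃) = d₁₂ , d₁₃ , d₂₃

xyz xzy yxz yzx zxy zyx : Bracket → AssocTerm
xyz b = mkTerm b vx vy vz (λ ()) (λ ()) (λ ())
xzy b = mkTerm b vx vz vy (λ ()) (λ ()) (λ ())
yxz b = mkTerm b vy vx vz (λ ()) (λ ()) (λ ())
yzx b = mkTerm b vy vz vx (λ ()) (λ ()) (λ ())
zxy b = mkTerm b vz vx vy (λ ()) (λ ()) (λ ())
zyx b = mkTerm b vz vy vx (λ ()) (λ ()) (λ ())

module Terms (A : Zroupoid) where

  open Zroupoid A

  shape : Bracket → Carrier → Carrier → Carrier → Carrier
  shape right a b c = a ⇒ (b ⇒ c)
  shape left  a b c = (a ⇒ b) ⇒ c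

  ⟦_⟧ : AssocTerm → (Var → Carrier) → Carrier
  ⟦ t ⟧ f = shape (br t) (f (v₁ t)) (f (v₂ t)) (f (v₃ t))

  ⟦⟧-at : ∀ t {f a b c} → f (v₁ t) ≡ a → f (v₂ t) ≡ b → f (v₃ t) ≡ c → ⟦ t ⟧ f ≡ shape (br t) a b c
  ⟦⟧-at t refl refl refl = refl

  Holds : AssocTerm → AssocTerm → Set
  Holds p q = ∀ f → ⟦ p ⟧ f ≡ ⟦ q ⟧ f

  Satisfies : AssocTerm → AssocTerm → Set
  Satisfies p q = ∀ a b c → eval A p a b c ≡ eval A q a b c

  private
    ⟦⟧-evalVar : ∀ p a b c → ⟦ p ⟧ (evalVar a b c) ≡ eval A p a b c
    ⟦⟧-evalVar (mkTerm right _ _ _ _ _ _) a b c = refl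
    ⟦⟧-evalVar (mkTerm left  _ _ _ _ _ _) a b c = refl

    evalVar-tabulate : ∀ (f : Var → Carrier) v → evalVar (f vx) (f vy) (f vz) v ≡ f v
    evalVar-tabulate f vx = refl
    evalVar-tabulate f vy = refl
    evalVar-tabulate f vz = refl

    eval-⟦⟧ : ∀ p f → eval A p (f vx) (f vy) (f vz) ≡ ⟦ p ⟧ f
    eval-⟦⟧ p f = trans (sym (⟦⟧-evalVar p _ _ _))
                        (⟦⟧-at p {evalVar (f vx) (f vy) (f vz)}
                           (evalVar-tabulate f _) (evalVar-tabulate f _) (evalVar-tabulate f _))

  satisfies⇒holds : ∀ p q → Satisfies p q → Holds p q
  satisfies⇒holds p q sat f = trans (sym (eval-⟦⟧ p f)) (trans (sat _ _ _) (eval-⟦⟧ q f))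

  holds⇒satisfies : ∀ p q → Holds p q → Satisfies p q
  holds⇒satisfies p q h a b c = trans (sym (⟦⟧-evalVar p a b c)) (trans (h _) (⟦⟧-evalVar q a b c))

module Specialisations (A : Zroupoid) (isS : IsS A) where

  open Zroupoid A
  open Symmetric A isS
  open Terms A

  spike dip : Var → Carrier → Var → Carrier
  spike v y = (λ _ → 𝟙) [ v ↦ y ]
  dip v y = (λ _ → y) [ v ↦ 𝟙 ]

  spike-first : ∀ t y → ⟦ t ⟧ (spike (v₁ t) y) ≡ shape (br t) y 𝟙 𝟙
  spike-first t@(mkTerm _ u _ _ d₁₂ d₁₃ _) y =
    ⟦⟧-at t ([↦]-≡ _ u y) ([↦]-≢ _ y (d₁₂ ∘ sym)) ([↦]-≢ _ y (d₁₃ ∘ sym))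

  spike-middle : ∀ t y → ⟦ t ⟧ (spike (v₂ t) y) ≡ y ⇒ 𝟙
  spike-middle t@(mkTerm b _ v _ d₁₂ _ d₂₃) y =
    trans (⟦⟧-at t ([↦]-≢ _ y d₁₂) ([↦]-≡ _ v y) ([↦]-≢ _ y (d₂₃ ∘ sym))) (value b)
    where
    value : ∀ b → shape b 𝟙 y 𝟙 ≡ y ⇒ 𝟙
    value right = ⇒-identityˡ (y ⇒ 𝟙)
    value left  = cong (_⇒ 𝟙) (⇒-identityˡ y)

  spike-last : ∀ t y → ⟦ t ⟧ (spike (v₃ t) y) ≡ y
  spike-last t@(mkTerm b _ _ w _ d₁₃ d₂₃) y =
    trans (⟦⟧-at t ([↦]-≢ _ y d₁₃) ([↦]-≢ _ y d₂₃) ([↦]-≡ _ w y)) (value b)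
    where
    value : ∀ b → shape b 𝟙 𝟙 y ≡ y
    value right = trans (⇒-identityˡ _) (⇒-identityˡ y)
    value left  = trans (cong (_⇒ y) (⇒-identityˡ 𝟙)) (⇒-identityˡ y)

  spike-right : ∀ {u v w} (d : Distinct u v w) {s} y → s ≢ w → ⟦ R⟨ d ⟩ ⟧ (spike s y) ≡ y ⇒ 𝟙
  spike-right d y s≢w with not-last d s≢w
  ... | inj₁ refl = trans (spike-first R⟨ d ⟩ y) (cong (y ⇒_) (⇒-identityˡ 𝟙))
  ... | inj₂ refl = spike-middle R⟨ d ⟩ y

  dip-first : ∀ t y → ⟦ t ⟧ (dip (v₁ t) y) ≡ y ⇒ y
  dip-first t@(mkTerm b u _ _ d₁₂ d₁₃ _) y =
    trans (⟦⟧-at t ([↦]-≡ _ u 𝟙) ([↦]-≢ _ 𝟙 (d₁₂ ∘ sym)) ([↦]-≢ _ 𝟙 (d₁₃ ∘ sym))) (value b)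
    where
    value : ∀ b → shape b 𝟙 y y ≡ y ⇒ y
    value right = ⇒-identityˡ (y ⇒ y)
    value left  = cong (_⇒ y) (⇒-identityˡ y)

  dip-middle : ∀ t y → ⟦ t ⟧ (dip (v₂ t) y) ≡ shape (br t) y 𝟙 y
  dip-middle t@(mkTerm _ _ v _ d₁₂ _ d₂₃) y =
    ⟦⟧-at t ([↦]-≢ _ 𝟙 d₁₂) ([↦]-≡ _ v 𝟙) ([↦]-≢ _ 𝟙 (d₂₃ ∘ sym))

  dip-middle-left : ∀ {u v w} (d : Distinct u v w) y → ⟦ L⟨ d ⟩ ⟧ (dip v y) ≡ y
  dip-middle-left d y = trans (dip-middle L⟨ d ⟩ y) (⇒𝟙⇒-absorb y)

  dip-right : ∀ {u v w} (d : Distinct u v w) {s} y → s ≢ w → ⟦ R⟨ d ⟩ ⟧ (dip s y) ≡ y ⇒ y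
  dip-right d y s≢w with not-last d s≢w
  ... | inj₁ refl = dip-first R⟨ d ⟩ y
  ... | inj₂ refl = trans (dip-middle R⟨ d ⟩ y) (cong (y ⇒_) (⇒-identityˡ y))

  spike-separates : ∀ p q v → (∀ y → ⟦ p ⟧ (spike v y) ≡ y) → (∀ y → ⟦ q ⟧ (spike v y) ≡ y ⇒ 𝟙) →
                    Holds p q → ∀ x → x ′ ≡ x
  spike-separates p q v p↦y q↦y⇒𝟙 p≈q =
    ⇒𝟙≡id⇒′≡id λ y → trans (sym (q↦y⇒𝟙 y)) (trans (sym (p≈q (spike v y))) (p↦y y))

  dip-separates : ∀ p q v → (∀ y → ⟦ p ⟧ (dip v y) ≡ y) → (∀ y → ⟦ q ⟧ (dip v y) ≡ y ⇒ y) →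
                  Holds p q → ∀ x → x ′ ≡ x
  dip-separates p q v p↦y q↦y⇒y p≈q =
    ⇒-idem⇒′≡id λ y → trans (sym (q↦y⇒y y)) (trans (sym (p≈q (dip v y))) (p↦y y))

module _ (A : Zroupoid) (isSL : IsSL A) where

  open Zroupoid A
  open Terms A
  open Symmetric A (SL⊆S A isSL) using (⇒-exchange)

  private
    ⇒-comm : ∀ x y → x ⇒ y ≡ y ⇒ x
    ⇒-comm = proj₂ (lower₁ (proj₂ isSL))

    rearrange : ∀ f {a b c a′ b′ c′} → Distinct a b c → Distinct a′ b′ c′ →
                f a ⇒ (f b ⇒ f c) ≡ f a′ ⇒ (f b′ ⇒ f c′)
    rearrange f = R-rearrange (λ a b c → a ⇒ (b ⇒ c)) ⇒-exchange f (λ a b c → cong (a ⇒_) (⇒-comm b c))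

    ⟦⟧≡xyz : ∀ t f → ⟦ t ⟧ f ≡ f vx ⇒ (f vy ⇒ f vz)
    ⟦⟧≡xyz (mkTerm right _ _ _ d₁₂ d₁₃ d₂₃) f = rearrange f (d₁₂ , d₁₃ , d₂₃) ((λ ()) , (λ ()) , (λ ()))
    ⟦⟧≡xyz (mkTerm left _ _ _ d₁₂ d₁₃ d₂₃) f =
      trans (⇒-comm _ _) (rearrange f (d₁₃ ∘ sym , d₂₃ ∘ sym , d₁₂) ((λ ()) , (λ ()) , (λ ())))

  SL-holds : ∀ p q → Holds p q
  SL-holds p q f = trans (⟦⟧≡xyz p f) (sym (⟦⟧≡xyz q f))

SL⊆SDef : ∀ p q → IsSL ⊆ᶜ SDef p q
SL⊆SDef p q A isSL = SL⊆S A isSL , lift₁ (Terms.holds⇒satisfies A p q (SL-holds A isSL p q))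

≐-sym : ∀ {K L} → K ≐ L → L ≐ K
≐-sym (K⊆L , L⊆K) = L⊆K , K⊆L

≐-trans : ∀ {K L N} → K ≐ L → L ≐ N → K ≐ N
≐-trans (K⊆L , L⊆K) (L⊆N , N⊆L) = (λ A → L⊆N A ∘ K⊆L A) , (λ A → L⊆K A ∘ N⊆L A)

Classified : Class → Set₁
Classified K = (K ≐ IsSL) ⊎ (K ≐ IsS14) ⊎ (K ≐ IsS)

pattern is-SL  e = inj₁ e
pattern is-S14 e = inj₂ (inj₁ e)
pattern is-S   e = inj₂ (inj₂ e)

Classified-resp : ∀ {K L} → K ≐ L → Classified L → Classified K
Classified-resp K≐L (is-SL e)  = is-SL (≐-trans K≐L e)
Classified-resp K≐L (is-S14 e) = is-S14 (≐-trans K≐L e)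
Classified-resp K≐L (is-S e)   = is-S (≐-trans K≐L e)

SDef-sym : ∀ p q → SDef p q ≐ SDef q p
SDef-sym p q = flip p q , flip q p
  where
  flip : ∀ p q → SDef p q ⊆ᶜ SDef q p
  flip _ _ A (isS , lift₁ sat) = isS , lift₁ λ a b c → sym (sat a b c)

SDef≐S : ∀ p q → (∀ A → IsS A → Terms.Holds A p q) → SDef p q ≐ IsS
SDef≐S p q valid = (λ _ → proj₁) , λ A isS → isS , lift₁ (Terms.holds⇒satisfies A p q (valid A isS))

SDef≐SL : ∀ p q → (∀ A (isS : IsS A) → Terms.Holds A p q → ∀ x → Zroupoid._′ A x ≡ x) → SDef p q ≐ IsSL
SDef≐SL p q forces-SL =
  (λ A (isS , lift₁ sat) → Symmetric.′≡id⇒IsSL A isS (forces-SL A isS (Terms.satisfies⇒holds A p q sat)))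
  , SL⊆SDef p q

module _ {u v w : Var} (d : Distinct u v w) where

  right-right-≡ : ∀ {u′ v′} (e : Distinct u′ v′ w) → SDef R⟨ d ⟩ R⟨ e ⟩ ≐ IsS
  right-right-≡ e = SDef≐S R⟨ d ⟩ R⟨ e ⟩ λ A isS f →
    R-same-last (λ a b c → Zroupoid._⇒_ A a (Zroupoid._⇒_ A b c)) (Symmetric.⇒-exchange A isS) f d e

  right-right-≢ : ∀ {u′ v′ w′} (e : Distinct u′ v′ w′) → w ≢ w′ → SDef R⟨ d ⟩ R⟨ e ⟩ ≐ IsSL
  right-right-≢ e w≢w′ = SDef≐SL R⟨ d ⟩ R⟨ e ⟩ λ A isS → let open Specialisations A isS in
    spike-separates R⟨ d ⟩ R⟨ e ⟩ w (spike-last R⟨ d ⟩) (λ y → spike-right e y w≢w′)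

  right-left-≡ : ∀ {u′ v′} (e : Distinct u′ v′ w) → SDef R⟨ d ⟩ L⟨ e ⟩ ≐ IsSL
  right-left-≡ {v′ = v′} e@(_ , _ , v′≢w) =
    SDef≐SL R⟨ d ⟩ L⟨ e ⟩ λ A isS p≈q → let open Specialisations A isS in
    dip-separates L⟨ e ⟩ R⟨ d ⟩ v′ (dip-middle-left e) (λ y → dip-right d y v′≢w) (λ f → sym (p≈q f))

  right-left-≢ : ∀ {u′ v′ w′} (e : Distinct u′ v′ w′) → w ≢ w′ → SDef R⟨ d ⟩ L⟨ e ⟩ ≐ IsSL
  right-left-≢ {w′ = w′} e w≢w′ =
    SDef≐SL R⟨ d ⟩ L⟨ e ⟩ λ A isS p≈q → let open Specialisations A isS in
    spike-separates L⟨ e ⟩ R⟨ d ⟩ w′ (spike-last L⟨ e ⟩) (λ y → spike-right d y (w≢w′ ∘ sym))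
                    (λ f → sym (p≈q f))

  left-left-swap : (e : Distinct v u w) → SDef L⟨ d ⟩ L⟨ e ⟩ ≐ IsSL
  left-left-swap e = SDef≐SL L⟨ d ⟩ L⟨ e ⟩ λ A isS → let open Specialisations A isS in
    dip-separates L⟨ d ⟩ L⟨ e ⟩ v (dip-middle-left d) (dip-first L⟨ e ⟩)

  left-left-middle : ∀ {u′ w′} (e : Distinct u′ w w′) → SDef L⟨ d ⟩ L⟨ e ⟩ ≐ IsSL
  left-left-middle e = SDef≐SL L⟨ d ⟩ L⟨ e ⟩ λ A isS → let open Specialisations A isS in
    spike-separates L⟨ d ⟩ L⟨ e ⟩ w (spike-last L⟨ d ⟩) (spike-middle L⟨ e ⟩)

  left-left-mirror : (e : Distinct w v u) → SDef L⟨ d ⟩ L⟨ e ⟩ ≐ IsS14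
  left-left-mirror e = to-S14 , from-S14
    where
    to-S14 : SDef L⟨ d ⟩ L⟨ e ⟩ ⊆ᶜ IsS14
    to-S14 A (isS , lift₁ sat) = (proj₁ isS , lift₁ a14) , isS
      where
      open Zroupoid A
      open Terms A
      a14 : ∀ x y z → (x ⇒ y) ⇒ z ≡ (z ⇒ y) ⇒ x
      a14 x y z = begin
        (x ⇒ y) ⇒ z    ≡⟨ sym (⟦⟧-at L⟨ d ⟩ {f} (assign-₁ d) (assign-₂ d) (assign-₃ d)) ⟩
        ⟦ L⟨ d ⟩ ⟧ f   ≡⟨ satisfies⇒holds L⟨ d ⟩ L⟨ e ⟩ sat f ⟩
        ⟦ L⟨ e ⟩ ⟧ f   ≡⟨ ⟦⟧-at L⟨ e ⟩ {f} (assign-₃ d) (assign-₂ d) (assign-₁ d) ⟩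
        (z ⇒ y) ⇒ x    ∎
        where
        f : Var → Carrier
        f = assign d x y z

    from-S14 : IsS14 ⊆ᶜ SDef L⟨ d ⟩ L⟨ e ⟩
    from-S14 A ((_ , lift₁ a14) , isS) =
      isS , lift₁ (Terms.holds⇒satisfies A L⟨ d ⟩ L⟨ e ⟩ λ f → a14 (f u) (f v) (f w))

classify : ∀ p q → Classified (SDef p q)
classify p@(mkTerm right _ _ p₃ _ _ _) q@(mkTerm right _ _ q₃ _ _ _) with p₃ ≟ᵥ q₃
... | yes refl = is-S (right-right-≡ (distinct p) (distinct q))
... | no p₃≢q₃ = is-SL (right-right-≢ (distinct p) (distinct q) p₃≢q₃)
classify p@(mkTerm right _ _ p₃ _ _ _) q@(mkTerm left _ _ q₃ _ _ _) with p₃ ≟ᵥ q₃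
... | yes refl = is-SL (right-left-≡ (distinct p) (distinct q))
... | no p₃≢q₃ = is-SL (right-left-≢ (distinct p) (distinct q) p₃≢q₃)
classify p@(mkTerm left _ _ p₃ _ _ _) q@(mkTerm right _ _ q₃ _ _ _) with q₃ ≟ᵥ p₃
... | yes refl = is-SL (≐-trans (SDef-sym p q) (right-left-≡ (distinct q) (distinct p)))
... | no q₃≢p₃ = is-SL (≐-trans (SDef-sym p q) (right-left-≢ (distinct q) (distinct p) q₃≢p₃))
classify p@(mkTerm left _ p₂ p₃ _ _ _) q@(mkTerm left _ q₂ q₃ _ _ _) with p₃ ≟ᵥ q₃
... | yes refl with same-last (distinct p) (distinct q)
...   | inj₁ (refl , refl) = is-S (SDef≐S p q λ _ _ _ → refl)
...   | inj₂ (refl , refl) = is-SL (left-left-swap (distinct p) (distinct q))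
classify p@(mkTerm left _ p₂ p₃ _ _ _) q@(mkTerm left _ q₂ q₃ _ _ _) | no p₃≢q₃ with p₃ ≟ᵥ q₂
... | yes refl = is-SL (left-left-middle (distinct p) (distinct q))
... | no p₃≢q₂ with q₃ ≟ᵥ p₂
...   | yes refl = is-SL (≐-trans (SDef-sym p q) (left-left-middle (distinct q) (distinct p)))
...   | no q₃≢p₂ with mirror-forced (distinct p) (distinct q) p₃≢q₃ p₃≢q₂ q₃≢p₂
...     | refl , refl , refl = is-S14 (left-left-mirror (distinct p) (distinct q))

assoc-type-classified : ∀ K → IsAssocType K → Classified K
assoc-type-classified K (p , q , K≐SDef) = Classified-resp K≐SDef (classify p q)

pattern 10F = suc 9F
pattern 11F = suc 10F
pattern 12F = suc 11F
pattern 13F = suc 12F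

defining-identity : ∀ i → Σ AssocTerm λ p → Σ AssocTerm λ q → ∀ A → Aid i A ≡ Terms.Satisfies A p q
defining-identity 0F = xyz right , xyz left , λ _ → refl
defining-identity 1F = xyz right , xzy right , λ _ → refl
defining-identity 2F = xyz right , xzy left , λ _ → refl
defining-identity 3F = xyz right , yxz right , λ _ → refl
defining-identity 4F = xyz right , yxz left , λ _ → refl
defining-identity 5F = xyz right , yzx right , λ _ → refl
defining-identity 6F = xyz right , yzx left , λ _ → refl
defining-identity 7F = xyz right , zxy left , λ _ → refl
defining-identity 8F = xyz right , zyx right , λ _ → refl
defining-identity 9F = xyz right , zyx left , λ _ → refl
defining-identity 10F = xyz left , xzy left , λ _ → refl
defining-identity 11F = xyz left , yxz left , λ _ → refl
defining-identity 12F = xyz left , yzx left , λ _ → refl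
defining-identity 13F = xyz left , zyx left , λ _ → refl

Si-classified : ∀ i → Classified (IsSi i)
Si-classified i with defining-identity i
... | p , q , Aid≡ = Classified-resp (to , from) (classify p q)
  where
  to : IsSi i ⊆ᶜ SDef p q
  to A ((_ , lift₁ h) , isS) = isS , lift₁ (subst (λ X → X) (Aid≡ A) h)
  from : SDef p q ⊆ᶜ IsSi i
  from A (isS , lift₁ h) = (proj₁ isS , lift₁ (subst (λ X → X) (sym (Aid≡ A)) h)) , isS

-- Finite models

Table : ℕ → Set
Table n = Vec (Vec (Fin n) n) n

cayley : ∀ {n} → Table n → Fin n → Zroupoid
cayley T o = record { Carrier = Fin _ ; _⇒_ = λ x y → lookup (lookup T x) y ; 𝟎 = o }

module Decide {n} (T : Table n) (o : Fin n) where

  open Zroupoid (cayley T o)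

  private
    lift? : ∀ {P} → Dec P → Dec (Lift₁ P)
    lift? = map′ lift₁ lower₁

  IsI? : Dec (IsI (cayley T o))
  IsI? = lift? ((all? λ x → all? λ y → all? λ z → (x ⇒ y) ⇒ z ≟ᶠ ((z ′ ⇒ x) ⇒ (y ⇒ z) ′) ′)
                ×-dec 𝟎 ′ ′ ≟ᶠ 𝟎)

  IsS? : Dec (IsS (cayley T o))
  IsS? = IsI? ×-dec lift? ((all? λ x → x ′ ′ ≟ᶠ x) ×-dec (all? λ x → all? λ y → x ∧ y ≟ᶠ y ∧ x))

  IsSL? : Dec (IsSL (cayley T o))
  IsSL? = IsI? ×-dec lift? ((all? λ x → x ′ ≟ᶠ x) ×-dec (all? λ x → all? λ y → x ⇒ y ≟ᶠ y ⇒ x))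

  IsBA? : Dec (IsBA (cayley T o))
  IsBA? = IsI? ×-dec lift? ((all? λ x → all? λ y → (x ⇒ y) ⇒ x ≟ᶠ x) ×-dec (all? λ x → x ⇒ x ≟ᶠ 𝟎 ′))

  IsS14? : Dec (IsS14 (cayley T o))
  IsS14? = (IsI? ×-dec lift? (all? λ x → all? λ y → all? λ z → (x ⇒ y) ⇒ z ≟ᶠ (z ⇒ y) ⇒ x)) ×-dec IsS?

𝟚-table : Table 2
𝟚-table = (# 1 ∷ # 1 ∷ [])
        ∷ (# 0 ∷ # 1 ∷ [])
        ∷ []

M₄-table : Table 4
M₄-table = (# 0 ∷ # 1 ∷ # 2 ∷ # 3 ∷ [])
         ∷ (# 2 ∷ # 3 ∷ # 2 ∷ # 3 ∷ [])
         ∷ (# 1 ∷ # 1 ∷ # 3 ∷ # 3 ∷ [])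
         ∷ (# 3 ∷ # 3 ∷ # 3 ∷ # 3 ∷ [])
         ∷ []

𝟚 M₄ : Zroupoid
𝟚 = cayley 𝟚-table (# 0)
M₄ = cayley M₄-table (# 0)

𝟚∈S : IsS 𝟚
𝟚∈S = from-yes (Decide.IsS? 𝟚-table (# 0))

𝟚∈BA : IsBA 𝟚
𝟚∈BA = from-yes (Decide.IsBA? 𝟚-table (# 0))

𝟚∉SL : ¬ IsSL 𝟚
𝟚∉SL = from-no (Decide.IsSL? 𝟚-table (# 0))

𝟚∉S14 : ¬ IsS14 𝟚
𝟚∉S14 = from-no (Decide.IsS14? 𝟚-table (# 0))

M₄∈S14 : IsS14 M₄
M₄∈S14 = from-yes (Decide.IsS14? M₄-table (# 0))

M₄∉SL : ¬ IsSL M₄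
M₄∉SL = from-no (Decide.IsSL? M₄-table (# 0))

SL-assoc-type : IsAssocType IsSL
SL-assoc-type =
  xyz right , xzy right , ≐-sym (right-right-≢ (distinct (xyz right)) (distinct (xzy right)) λ ())

A14≐S14 : SDef (xyz left) (zyx left) ≐ IsS14
A14≐S14 = left-left-mirror (distinct (xyz left)) (distinct (zyx left))

S14-assoc-type : IsAssocType IsS14
S14-assoc-type = xyz left , zyx left , ≐-sym A14≐S14

S-assoc-type : IsAssocType IsS
S-assoc-type = xyz right , xyz right , ≐-sym (SDef≐S (xyz right) (xyz right) λ _ _ _ → refl)

SL⊂S14 : IsSL ⊂ᶜ IsS14
SL⊂S14 = (λ A → proj₁ A14≐S14 A ∘ SL⊆SDef (xyz left) (zyx left) A) , M₄ , M₄∈S14 , M₄∉SL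

theorem5p7 :
    -- (a) the subvarieties of 𝒮 of associative type are exactly 𝒮ℒ, 𝒮₁₄, 𝒮
    ( (IsAssocType IsSL × IsAssocType IsS14 × IsAssocType IsS)
    × (∀ (K : Class) → IsAssocType K → (K ≐ IsSL) ⊎ (K ≐ IsS14) ⊎ (K ≐ IsS))
    × (∀ (i : Fin 14) → (IsSi i ≐ IsSL) ⊎ (IsSi i ≐ IsS14) ⊎ (IsSi i ≐ IsS))
    × ¬ (IsSL ≐ IsS14) × ¬ (IsS14 ≐ IsS) × ¬ (IsSL ≐ IsS) )
    -- (b) 𝒮ℒ ⊂ 𝒮₁₄ ⊂ 𝒮 and ℬ𝒜 ⊈ 𝒮₁₄
    × ( (IsSL ⊂ᶜ IsS14) × (IsS14 ⊂ᶜ IsS) × ¬ (IsBA ⊆ᶜ IsS14) )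
theorem5p7 =
  ( (SL-assoc-type , S14-assoc-type , S-assoc-type)
  , assoc-type-classified
  , Si-classified
  , (λ SL≐S14 → M₄∉SL (proj₂ SL≐S14 M₄ M₄∈S14))
  , (λ S14≐S → 𝟚∉S14 (proj₂ S14≐S 𝟚 𝟚∈S))
  , (λ SL≐S → 𝟚∉SL (proj₂ SL≐S 𝟚 𝟚∈S)) )
  , ( SL⊂S14
    , ((λ _ → proj₂) , 𝟚 , 𝟚∈S , 𝟚∉S14)
    , (λ BA⊆S14 → 𝟚∉S14 (BA⊆S14 𝟚 𝟚∈BA)) )
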